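{- Let $L=\mathcal O(m;j_1,\dots,j_k)$ and $L'=\mathcal O(m';j'_1,\dots,j'_k)$ be parabolic line bundles on $\mathbb P^1$ over a finite field $\mathbf k$ with marked points $s_1,\dots,s_k$. If $\mathrm{Hom}(L,L')\neq0$, then $L\le L'$, where $L\le L'$ means $(m,-j_1,\dots,-j_k)\le(m',-j'_1,\dots,-j'_k)$ in lexicographic order.
   Context: Fix $N\ge1$ and distinct rational points $s_1,\dots,s_k\in\mathbb P^1(\mathbf k)$. A parabolic bundle is a vector bundle $\mathcal E$ with, for each $i$, a flag $0=F_{i,0}\subseteq\dots\subseteq F_{i,N}=\mathcal E(s_i)$ of the fiber at $s_i$. A morphism of parabolic bundles is a bundle map whose restriction to each fiber $\mathcal E(s_i)$ maps $F_{i,j}$ into $F'_{i,j}$ for all $j$. $\mathcal O(m;j_1,\dots,j_k)$, with $1\le j_i\le N$, is the parabolic line bundle with underlying bundle $\mathcal O(m)$ and flags $F_{i,j}=0$ for $j<j_i$, $F_{i,j}=\mathcal O(m)(s_i)$ for $j\ge j_i$. -}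

module Defs where

open import Level using (Level; _⊔_; suc)
open import Algebra.Bundles using (CommutativeRing)
open import Data.Nat as ℕ using (ℕ; zero) renaming (suc to sucℕ)
open import Data.Integer as ℤ using (ℤ; +_; -_)
open import Data.Fin using (Fin)
open import Data.Vec using (Vec; []; _∷_; lookup)
open import Data.List using (List)
open import Data.List.Membership.Setoid using ()
open import Data.List.Relation.Unary.Any using (Any)
open import Data.Product using (Σ; ∃; _×_; _,_)
open import Relation.Nullary using (¬_)
open import Relation.Binary.PropositionalEquality using (_≡_)

record FiniteField (c ℓ : Level) : Set (suc (c ⊔ ℓ)) where
  field
    commRing : CommutativeRing c ℓ
  open CommutativeRing commRing public
  field
    1≉0      : ¬ (1# ≈ 0#)
    inverse  : ∀ x → ¬ (x ≈ 0#) → Σ Carrier λ y → x * y ≈ 1#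
    elements : List Carrier
    complete : ∀ x → Any (x ≈_) elements

module _ {c ℓ} (F : FiniteField c ℓ) where
  open FiniteField F

  pow : Carrier → ℕ → Carrier
  pow x zero = 1#
  pow x (sucℕ n) = x * pow x n

  -- A rational point of P¹(k), in homogeneous coordinates [a : b],
  -- (a , b) ≠ (0 , 0).
  Point : Set (c ⊔ ℓ)
  Point = Σ (Carrier × Carrier) λ { (a , b) → ¬ ((a ≈ 0#) × (b ≈ 0#)) }

  SamePoint : Point → Point → Set ℓ
  SamePoint ((a , b) , _) ((a' , b') , _) = a * b' ≈ a' * b

  -- Homogeneous polynomial of degree d in X, Y, i.e. a global section of
  -- O(d) on P¹: coefficient vector (c₀ , … , c_d) standing for
  -- Σ cᵢ Xⁱ Y^(d-i).
  HomPoly : ℕ → Set c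
  HomPoly d = Vec Carrier (sucℕ d)

  evalH : ∀ d → HomPoly d → Carrier → Carrier → Carrier
  evalH zero (c₀ ∷ []) a b = c₀
  evalH (sucℕ d) (c₀ ∷ cs) a b = c₀ * pow b (sucℕ d) + a * evalH d cs a b

  NonZeroPoly : ∀ {d} → HomPoly d → Set ℓ
  NonZeroPoly {d} p = ∃ λ (i : Fin (sucℕ d)) → ¬ (lookup p i ≈ 0#)

  -- Vanishing of a section at a point (well defined up to scaling).
  VanishesAt : ∀ {d} → HomPoly d → Point → Set ℓ
  VanishesAt {d} p ((a , b) , _) = evalH d p a b ≈ 0#

-- Parabolic line bundles O(m; j₁,…,j_k) with flags of length N.

record ParLine (k N : ℕ) : Set where
  constructor 𝒪
  field
    deg   : ℤ
    index : Fin k → ℕ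
open ParLine public

ValidParLine : ∀ {k N} → ParLine k N → Set
ValidParLine {k} {N} L = ∀ (i : Fin k) → (1 ℕ.≤ index L i) × (index L i ℕ.≤ N)

-- For a line fiber, each flag step F_{i,j} is either 0 or the whole fiber.
-- F_{i,j} is the whole fiber iff j ≥ j_i.
FlagFull : ∀ {k N} → ParLine k N → Fin k → ℕ → Set
FlagFull L i j = index L i ℕ.≤ j

FlagZero : ∀ {k N} → ParLine k N → Fin k → ℕ → Set
FlagZero L i j = j ℕ.< index L i

module _ {c ℓ} (F : FiniteField c ℓ) where
  open FiniteField F

  -- The underlying bundle map
  -- O(m) → O(m') is a section of O(m' - m), i.e. a homogeneous polynomial
  -- of degree d = m' - m (no nonzero ones if m' < m).  The fibre map at
  -- s_i is multiplication by the value of the section at s_i; it sends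
  -- F_{i,j} into F'_{i,j} iff it does not map the full fibre into 0 unless
  -- it vanishes at s_i.
  record NonZeroParHom {k N} (s : Fin k → Point F) (L L' : ParLine k N)
         : Set (c ⊔ ℓ) where
    field
      d        : ℕ
      degEq    : deg L' ≡ deg L ℤ.+ + d
      section  : HomPoly F d
      nonzero  : NonZeroPoly F section
      respects : ∀ (i : Fin k) (j : ℕ) → j ℕ.≤ N →
                 FlagFull L i j → FlagZero L' i j → VanishesAt F section (s i)

data LexLeq : ∀ {n} → Vec ℤ n → Vec ℤ n → Set where
  lex-[] : LexLeq [] []
  lex-<  : ∀ {n x y} {xs ys : Vec ℤ n} → x ℤ.< y → LexLeq (x ∷ xs) (y ∷ ys)
  lex-≡  : ∀ {n x y} {xs ys : Vec ℤ n} → x ≡ y → LexLeq xs ys →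
           LexLeq (x ∷ xs) (y ∷ ys)

lexKey : ∀ {k N} → ParLine k N → Vec ℤ (sucℕ k)
lexKey {k} L = deg L ∷ Data.Vec.tabulate (λ i → - (+ index L i))

_≤ᴾ_ : ∀ {k N} → ParLine k N → ParLine k N → Set
L ≤ᴾ L' = LexLeq (lexKey L) (lexKey L')

{-# OPTIONS --safe #-}
module Submission where

-- A nonzero morphism L → L' is a nonzero section of O(m' - m), so m ≤ m'.  If m < m' we are
-- done; if m = m' the section is a nonzero constant, which vanishes at no s_i, and then
-- the flag condition at step j_i forces j'_i ≤ j_i for every i.

open import Defs
open import Data.Nat using (ℕ; zero; suc; _≤_; z<s)
import Data.Nat.Properties as ℕ
open import Data.Integer as ℤ using (ℤ; +_; +[1+_]; +<+; +≤+)
import Data.Integer.Properties as ℤ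
open import Data.Fin using (Fin; zero)
open import Data.Vec using (Vec; []; _∷_)
open import Data.Vec.Relation.Binary.Pointwise.Inductive using (Pointwise; []; _∷_; tabulate⁺)
open import Data.Product using (_,_; proj₂)
open import Relation.Binary.PropositionalEquality using (_≡_; sym; trans; subst)
open import Relation.Nullary using (¬_; yes; no)

≤-pointwise⇒LexLeq : ∀ {n} {xs ys : Vec ℤ n} → Pointwise ℤ._≤_ xs ys → LexLeq xs ys
≤-pointwise⇒LexLeq [] = lex-[]
≤-pointwise⇒LexLeq {xs = x ∷ _} {ys = y ∷ _} (x≤y ∷ xs≤ys) with x ℤ.≟ y
... | yes x≡y = lex-≡ x≡y (≤-pointwise⇒LexLeq xs≤ys)
... | no x≢y  = lex-< (ℤ.≤∧≢⇒< x≤y x≢y)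

i<i+[1+n] : ∀ i n → i ℤ.< i ℤ.+ +[1+ n ]
i<i+[1+n] i n = begin-strict
  i              ≡⟨ sym (ℤ.+-identityʳ i) ⟩
  i ℤ.+ + 0      <⟨ ℤ.+-monoʳ-< i (+<+ z<s) ⟩
  i ℤ.+ +[1+ n ] ∎
  where open ℤ.≤-Reasoning

module _ {c ℓ} (F : FiniteField c ℓ) where
  open FiniteField F

  constant-nowhereVanishing : (p : HomPoly F 0) → NonZeroPoly F p → ∀ x → ¬ VanishesAt F p x
  constant-nowhereVanishing (_ ∷ []) (zero , c₀≉0) _ = c₀≉0

  index-antitone-where-nonvanishing :
    ∀ {k N} {s : Fin k → Point F} {L L' : ParLine k N} → ValidParLine L →
    (φ : NonZeroParHom F s L L') →
    ∀ i → ¬ VanishesAt F (NonZeroParHom.section φ) (s i) → index L' i ≤ index L i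
  index-antitone-where-nonvanishing {L = L} validL φ i nonvanishing =
    ℕ.≮⇒≥ λ jᵢ<j'ᵢ →
      nonvanishing (NonZeroParHom.respects φ i (index L i) (proj₂ (validL i)) ℕ.≤-refl jᵢ<j'ᵢ)

proposition5p6 : ∀ {c ℓ} (F : FiniteField c ℓ) (N k : ℕ) → 1 ≤ N →
    (s : Fin k → Point F) →
    (∀ (i i' : Fin k) → ¬ (i ≡ i') → ¬ SamePoint F (s i) (s i')) →
    (L L' : ParLine k N) → ValidParLine L → ValidParLine L' →
    NonZeroParHom F s L L' → L ≤ᴾ L'
proposition5p6 F _ _ _ _ _ L L' _ _ record { d = suc n ; degEq = m'≡m+d } =
  lex-< (subst (deg L ℤ.<_) (sym m'≡m+d) (i<i+[1+n] (deg L) n))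
proposition5p6 F _ _ _ s _ L L' validL _ φ@record { d = zero ; degEq = m'≡m+0 ; section = p ; nonzero = p≉0 } =
  lex-≡ (trans (sym (ℤ.+-identityʳ (deg L))) (sym m'≡m+0))
        (≤-pointwise⇒LexLeq (tabulate⁺ λ i → ℤ.neg-mono-≤ (+≤+ (j'ᵢ≤jᵢ i))))
  where
  j'ᵢ≤jᵢ : ∀ i → index L' i ≤ index L i
  j'ᵢ≤jᵢ i = index-antitone-where-nonvanishing F validL φ i (constant-nowhereVanishing F p p≉0 (s i))
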